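{- For every $\epsilon \in (3/4, 1)$ there is a subpolynomial function $h = h_\epsilon$ (i.e. $h(n) = n^{o(1)}$) such that for every set $X$ of $n$ integers there exists $Y \subseteq X$ with $|Y| \leqslant \epsilon n$ such that $X \setminus Y$ can be compressed into a subset of the segment $\{1, \dots, \lfloor n h(n)\rfloor\}$.
   Context: For a set of integers $X=\{x_1,\dots,x_n\}$ (distinct elements), a set $Y=\{y_1,\dots,y_n\}$ (distinct elements) is called a compression of $X$ if for all triples $(i,j,k)\in\{1,\dots,n\}^3$, the equality $x_i - 2x_j + x_k = 0$ implies $y_i - 2y_j + y_k = 0$ (no ordering of the $x_i$ or $y_i$ is assumed). "$X$ can be compressed into a subset of $S$" means there exists a compression $Y$ of $X$ with $Y \subseteq S$. -}

module Defs where

open import Data.Nat as ℕ using (ℕ; suc; _^_)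
open import Data.Integer as ℤ using (ℤ; +_; _-_; _*_; _+_)
open import Data.Fin using (Fin)
open import Data.Fin.Subset using (Subset; _∉_)
open import Data.Product using (Σ; ∃; _×_)
open import Relation.Binary.PropositionalEquality using (_≡_)

-- A function h : ℕ → ℕ is subpolynomial (h(n) = n^{o(1)}):
-- for every k ≥ 1, eventually h(n) ≤ n^{1/k}, i.e. h(n)^k ≤ n.
Subpolynomial : (ℕ → ℕ) → Set
Subpolynomial h = ∀ (k : ℕ) → ∃ λ (N : ℕ) → ∀ (n : ℕ) → N ℕ.≤ n → h n ^ suc k ℕ.≤ n

triple : ℤ → ℤ → ℤ → ℤ
triple a b c = a - (+ 2) * b + c

-- The set X = {x_i : i ∈ Fin n} (x injective); R ⊆ Fin n indexes the removed part Y,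
-- so X \ Y = {x_i : i ∉ R}.  y (restricted to indices outside R) is a compression of
-- X \ Y into {1, …, m}.
CompressibleInto : {n : ℕ} → (Fin n → ℤ) → Subset n → ℕ → Set
CompressibleInto {n} x R m =
  Σ (Fin n → ℤ) λ y →
    (∀ i j → i ∉ R → j ∉ R → y i ≡ y j → i ≡ j)
    × (∀ i j k → i ∉ R → j ∉ R → k ∉ R →
         triple (x i) (x j) (x k) ≡ + 0 → triple (y i) (y j) (y k) ≡ + 0)
    × (∀ i → i ∉ R → (+ 1 ℤ.≤ y i) × (y i ℤ.≤ + m))

module Submission where

open import Defs
open import Data.Nat using (ℕ; _*_; _<_; _≤_)
open import Data.Integer using (ℤ)
open import Data.Fin using (Fin)
open import Data.Fin.Subset using (Subset; ∣_∣)
open import Data.Product using (Σ; ∃; _×_)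
open import Function.Definitions using (Injective)
open import Relation.Binary.PropositionalEquality using (_≡_)

-- Choose a modulus Q coprime to every difference x i - x j and look at the residues
-- (l x i + s) mod Q for l, s < Q, written in base B as (bucket, offset). A point lands
-- if its bucket is below T and its offset below b, where b = B / 2 and T B ≈ Q / 2: the
-- residues of landed points add without wrapping around Q and their offsets add without
-- carry, so a 3-term progression of landed points is a 3-term progression of buckets.
-- Keeping only the first landed point of each bucket, the buckets shifted by one
-- compress the survivors into {1, …, T}. Averaged over (l, s) a quarter of the points
-- land, while by coprimality a pair collides for at most 2b of the Q dilations l, i.e.
-- about n / (8q) collisions when T = 4qn; since 3q < 4p this removes at most (p / q) n
-- points, so the constant h = 4q works.

open import Data.Nat
open import Data.Nat.Properties
open import Data.Nat.DivMod
  using (_/_; _%_; m≡m%n+[m/n]*n; m%n<n; +-distrib-/; +-distrib-/-∣ʳ; [m+kn]%n≡m%n; m<n⇒m%n≡m; m<n⇒m/n≡0; m*n/n≡m)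
open import Data.Nat.Divisibility
open import Data.Nat.Coprimality using (Coprime; coprime-divisor)
open import Data.Nat.Tactic.RingSolver renaming (solve-∀ to ℕ-solve-∀)
import Data.Integer as ℤ
import Data.Integer.Properties as ℤ
import Data.Integer.Divisibility.Signed as ℤ
open import Data.Integer using (+_)
open import Data.Integer.DivMod using (_%ℕ_; _/ℕ_; a≡a%ℕn+[a/ℕn]*n; n%ℕd<d)
open import Data.Integer.Tactic.RingSolver using (solve-∀)
open import Data.Fin as Fin using (zero; suc; toℕ; fromℕ<; remQuot; combine)
import Data.Fin.Properties as Fin
open import Data.Fin.Subset using (_∉_)
open import Data.Vec using ([]; tabulate)
open import Data.Vec.Properties using (lookup∘tabulate; lookup⇒[]=)
open import Data.Product using (_,_; proj₁; uncurry)
open import Function using (_∘_)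
open import Relation.Nullary using (Dec; yes; no; ¬_; contradiction)
open import Relation.Nullary.Decidable using (isNo; map′; _×-dec_; ¬?)
open import Relation.Unary using (Pred; Decidable)
open import Relation.Binary using (tri<; tri≈; tri>)
open import Relation.Binary.PropositionalEquality
open import Algebra.Properties.Semiring.Sum +-*-semiring using (sum; ∑-comm; ∑-distrib-+; *-distribˡ-sum)

-- Finite sums and counting

𝟙 : ∀ {p} {P : Set p} → Dec P → ℕ
𝟙 (yes _) = 1
𝟙 (no _)  = 0

𝟙-yes : ∀ {p} {P : Set p} (P? : Dec P) → P → 𝟙 P? ≡ 1
𝟙-yes (yes _) _ = refl
𝟙-yes (no ¬p) p = contradiction p ¬p

𝟙-≤ : ∀ {p} {P : Set p} (P? : Dec P) {m} → (P → 1 ≤ m) → 𝟙 P? ≤ m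
𝟙-≤ (yes p) P⇒1≤m = P⇒1≤m p
𝟙-≤ (no _)  _     = z≤n

count : ∀ {n p} {P : Pred (Fin n) p} → Decidable P → ℕ
count P? = sum (λ i → 𝟙 (P? i))

sum-const : ∀ n c → sum {n} (λ _ → c) ≡ n * c
sum-const zero    c = refl
sum-const (suc n) c = cong (_+_ c) (sum-const n c)

sum-cong : ∀ {n} {f g : Fin n → ℕ} → (∀ i → f i ≡ g i) → sum f ≡ sum g
sum-cong {zero}  f≗g = refl
sum-cong {suc n} f≗g = cong₂ _+_ (f≗g zero) (sum-cong (f≗g ∘ suc))

sum-mono-≤ : ∀ {n} {f g : Fin n → ℕ} → (∀ i → f i ≤ g i) → sum f ≤ sum g
sum-mono-≤ {zero}  f≤g = z≤n
sum-mono-≤ {suc n} f≤g = +-mono-≤ (f≤g zero) (sum-mono-≤ (f≤g ∘ suc))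

sum-mono-< : ∀ {n} .{{_ : NonZero n}} {f g : Fin n → ℕ} → (∀ i → f i < g i) → sum f < sum g
sum-mono-< {suc n} f<g = +-mono-<-≤ (f<g zero) (sum-mono-≤ (<⇒≤ ∘ f<g ∘ suc))

term≤sum : ∀ {n} (f : Fin n → ℕ) i → f i ≤ sum f
term≤sum f zero    = m≤m+n _ _
term≤sum f (suc i) = ≤-trans (term≤sum (f ∘ suc) i) (m≤n+m _ (f zero))

sum≤sum⇒∃≤ : ∀ {n} .{{_ : NonZero n}} (f g : Fin n → ℕ) → sum f ≤ sum g → ∃ λ i → f i ≤ g i
sum≤sum⇒∃≤ f g Σf≤Σg with Fin.any? (λ i → f i ≤? g i)
... | yes found = found
... | no ¬found = contradiction Σf≤Σg (<⇒≱ (sum-mono-< λ i → ≰⇒> λ fᵢ≤gᵢ → ¬found (i , fᵢ≤gᵢ)))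

sum-affine : ∀ {n} q c (f : Fin n → ℕ) → sum (λ a → q * f a + c) ≡ q * sum f + n * c
sum-affine {n} q c f = begin
  sum (λ a → q * f a + c)                  ≡⟨ ∑-distrib-+ (λ a → q * f a) (λ _ → c) ⟩
  sum (λ a → q * f a) + sum {n} (λ _ → c)  ≡⟨ cong₂ _+_ (*-distribˡ-sum q f) (sym (sum-const n c)) ⟨
  q * sum f + n * c                        ∎
  where open ≡-Reasoning

none⇒count≡0 : ∀ {n p} {P : Pred (Fin n) p} (P? : Decidable P) → (∀ i → ¬ P i) → count P? ≡ 0
none⇒count≡0 {zero}  P? ¬P = refl
none⇒count≡0 {suc n} P? ¬P with P? zero
... | yes p = contradiction p (¬P zero)
... | no  _ = none⇒count≡0 (P? ∘ suc) (¬P ∘ suc)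

unique⇒count≤1 : ∀ {n p} {P : Pred (Fin n) p} (P? : Decidable P) →
                 (∀ i j → P i → P j → i ≡ j) → count P? ≤ 1
unique⇒count≤1 {zero}  P? unique = z≤n
unique⇒count≤1 {suc n} P? unique with P? zero
... | yes p = ≤-reflexive (cong suc (none⇒count≡0 (P? ∘ suc) λ i pᵢ →
                contradiction (unique zero (suc i) p pᵢ) λ ()))
... | no  _ = unique⇒count≤1 (P? ∘ suc) λ i j pᵢ pⱼ → Fin.suc-injective (unique (suc i) (suc j) pᵢ pⱼ)

injection⇒≤count : ∀ {m n p} {P : Pred (Fin n) p} (P? : Decidable P) (φ : Fin m → Fin n) →
                   Injective _≡_ _≡_ φ → (∀ a → P (φ a)) → m ≤ count P?
injection⇒≤count {m} {P = P} P? φ φ-injective Pφ = begin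
  m                                        ≡⟨ trans (sum-const m 1) (*-identityʳ m) ⟨
  sum {m} (λ _ → 1)                        ≤⟨ sum-mono-≤ hit ⟩
  sum (λ a → count (λ c → φ a Fin.≟ c))    ≡⟨ ∑-comm (λ a c → 𝟙 (φ a Fin.≟ c)) ⟩
  sum (λ c → count (λ a → φ a Fin.≟ c))    ≤⟨ sum-mono-≤ fibre≤ ⟩
  count P?                                 ∎
  where
  open ≤-Reasoning
  hit : ∀ a → 1 ≤ count (λ c → φ a Fin.≟ c)
  hit a = ≤-trans (≤-reflexive (sym (𝟙-yes (φ a Fin.≟ φ a) refl))) (term≤sum (λ c → 𝟙 (φ a Fin.≟ c)) (φ a))
  fibre≤ : ∀ c → count (λ a → φ a Fin.≟ c) ≤ 𝟙 (P? c)
  fibre≤ c with P? c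
  ... | yes _  = unique⇒count≤1 (λ a → φ a Fin.≟ c) λ a a' φa≡c φa'≡c →
                   φ-injective (trans φa≡c (sym φa'≡c))
  ... | no ¬Pc = ≤-reflexive (none⇒count≡0 (λ a → φ a Fin.≟ c) λ a φa≡c → ¬Pc (subst P φa≡c (Pφ a)))

count≤∑count : ∀ {m n p r} {P : Pred (Fin n) p} {R : Fin n → Fin m → Set r}
               (P? : Decidable P) (R? : ∀ a u → Dec (R a u)) →
               (∀ a → P a → ∃ λ u → R a u) → count P? ≤ sum (λ u → count (λ a → R? a u))
count≤∑count P? R? P⇒R = begin
  count P?                                ≤⟨ sum-mono-≤ covered ⟩
  sum (λ a → sum (λ u → 𝟙 (R? a u)))      ≡⟨ ∑-comm (λ a u → 𝟙 (R? a u)) ⟩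
  sum (λ u → count (λ a → R? a u))        ∎
  where
  open ≤-Reasoning
  covered : ∀ a → 𝟙 (P? a) ≤ sum (λ u → 𝟙 (R? a u))
  covered a = 𝟙-≤ (P? a) λ Pa → let u , Rau = P⇒R a Pa in
    ≤-trans (≤-reflexive (sym (𝟙-yes (R? a u) Rau))) (term≤sum (λ u → 𝟙 (R? a u)) u)

∣tabulate-isNo∣+count≡n : ∀ {n p} {P : Pred (Fin n) p} (P? : Decidable P) →
                          ∣ tabulate (isNo ∘ P?) ∣ + count P? ≡ n
∣tabulate-isNo∣+count≡n {zero}  P? = refl
∣tabulate-isNo∣+count≡n {suc n} P? with P? zero | ∣tabulate-isNo∣+count≡n (P? ∘ suc)
... | yes _ | ih = trans (+-suc _ _) (cong suc ih)
... | no  _ | ih = cong suc ih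

∉tabulate-isNo : ∀ {n p} {P : Pred (Fin n) p} (P? : Decidable P) i → i ∉ tabulate (isNo ∘ P?) → P i
∉tabulate-isNo P? i i∉ with P? i in eq
... | yes Pi = Pi
... | no  _  = contradiction (lookup⇒[]= i _ (trans (lookup∘tabulate (isNo ∘ P?) i) (cong isNo eq))) i∉

-- Congruences of integers

∣∧<⇒≡0 : ∀ {m d} → m ∣ d → d < m → d ≡ 0
∣∧<⇒≡0 {d = zero}  _   _   = refl
∣∧<⇒≡0 {d = suc _} m∣d d<m = contradiction m∣d (>⇒∤ d<m)

-- A record rather than a synonym for divisibility, so that a and b can be inferred.
infix 4 _≡_mod_
record _≡_mod_ (a b : ℤ.ℤ) (m : ℕ) : Set where
  constructor mod-divides
  field
    divides-difference : + m ℤ.∣ a ℤ.- b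

open _≡_mod_

infix 4 _≡?_mod_
_≡?_mod_ : ∀ a b m → Dec (a ≡ b mod m)
a ≡? b mod m = map′ mod-divides divides-difference (+ m ℤ.∣? a ℤ.- b)

module _ {m : ℕ} where

  mod-reflexive : ∀ {a b} → a ≡ b → a ≡ b mod m
  mod-reflexive {a} refl = mod-divides (ℤ.divides (+ 0) (ℤ.+-inverseʳ a))

  mod-sym : ∀ {a b} → a ≡ b mod m → b ≡ a mod m
  mod-sym {a} {b} (mod-divides m∣a-b) = mod-divides (subst (+ m ℤ.∣_) (negate a b) (ℤ.∣m⇒∣-m m∣a-b))
    where
    negate : ∀ a b → ℤ.- (a ℤ.- b) ≡ b ℤ.- a
    negate = solve-∀

  mod-trans : ∀ {a b c} → a ≡ b mod m → b ≡ c mod m → a ≡ c mod m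
  mod-trans {a} {b} {c} (mod-divides m∣a-b) (mod-divides m∣b-c) =
    mod-divides (subst (+ m ℤ.∣_) (telescope a b c) (ℤ.∣m∣n⇒∣m+n m∣a-b m∣b-c))
    where
    telescope : ∀ a b c → (a ℤ.- b) ℤ.+ (b ℤ.- c) ≡ a ℤ.- c
    telescope = solve-∀

  +-cong-mod : ∀ {a b c d} → a ≡ b mod m → c ≡ d mod m → a ℤ.+ c ≡ b ℤ.+ d mod m
  +-cong-mod {a} {b} {c} {d} (mod-divides m∣a-b) (mod-divides m∣c-d) =
    mod-divides (subst (+ m ℤ.∣_) (regroup a b c d) (ℤ.∣m∣n⇒∣m+n m∣a-b m∣c-d))
    where
    regroup : ∀ a b c d → (a ℤ.- b) ℤ.+ (c ℤ.- d) ≡ (a ℤ.+ c) ℤ.- (b ℤ.+ d)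
    regroup = solve-∀

  difference-cong-mod : ∀ {a b c d} → a ≡ b mod m → c ≡ d mod m → a ℤ.- c ≡ b ℤ.- d mod m
  difference-cong-mod {a} {b} {c} {d} (mod-divides m∣a-b) (mod-divides m∣c-d) =
    mod-divides (subst (+ m ℤ.∣_) (regroup a b c d) (ℤ.∣m∣n⇒∣m-n m∣a-b m∣c-d))
    where
    regroup : ∀ a b c d → (a ℤ.- b) ℤ.- (c ℤ.- d) ≡ (a ℤ.- c) ℤ.- (b ℤ.- d)
    regroup = solve-∀

  %ℕ-mod : .{{_ : NonZero m}} → ∀ z → z ≡ + (z %ℕ m) mod m
  %ℕ-mod z = mod-divides (ℤ.divides (z /ℕ m) (begin
    z ℤ.- + r                          ≡⟨ cong (ℤ._- + r) (a≡a%ℕn+[a/ℕn]*n z m) ⟩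
    (+ r ℤ.+ z /ℕ m ℤ.* + m) ℤ.- + r    ≡⟨ cancel (+ r) (z /ℕ m) (+ m) ⟩
    z /ℕ m ℤ.* + m                     ∎))
    where
    open ≡-Reasoning
    r : ℕ
    r = z %ℕ m
    cancel : ∀ a b c → (a ℤ.+ b ℤ.* c) ℤ.- a ≡ b ℤ.* c
    cancel = solve-∀

  <-mod⇒≡ : ∀ {a b} → a < m → b < m → + a ≡ + b mod m → a ≡ b
  <-mod⇒≡ {a} {b} a<m b<m (mod-divides m∣a-b) =
    ℤ.+-injective (ℤ.i-j≡0⇒i≡j (+ a) (+ b) (ℤ.∣i∣≡0⇒i≡0 ∣a-b∣≡0))
    where
    ∣a-b∣<m : ℤ.∣ + a ℤ.- + b ∣ < m
    ∣a-b∣<m = subst (_< m) (cong ℤ.∣_∣ (sym (ℤ.m-n≡m⊖n a b)))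
                (≤-<-trans (ℤ.∣m⊝n∣≤m⊔n a b) (⊔-lub a<m b<m))
    ∣a-b∣≡0 : ℤ.∣ + a ℤ.- + b ∣ ≡ 0
    ∣a-b∣≡0 = ∣∧<⇒≡0 (ℤ.∣⇒∣ᵤ m∣a-b) ∣a-b∣<m

  *-cancelʳ-mod : ∀ {a b d} → Coprime m ℤ.∣ d ∣ → a ℤ.* d ≡ b ℤ.* d mod m → a ≡ b mod m
  *-cancelʳ-mod {a} {b} {d} coprime (mod-divides m∣ad-bd) =
    mod-divides (ℤ.∣ᵤ⇒∣ (coprime-divisor coprime m∣∣d∣∣a-b∣))
    where
    factor : ∀ a b d → a ℤ.* d ℤ.- b ℤ.* d ≡ (a ℤ.- b) ℤ.* d
    factor = solve-∀
    m∣∣d∣∣a-b∣ : m ∣ ℤ.∣ d ∣ * ℤ.∣ a ℤ.- b ∣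
    m∣∣d∣∣a-b∣ = subst (m ∣_) (trans (cong ℤ.∣_∣ (factor a b d))
                                     (trans (ℤ.abs-* (a ℤ.- b) d) (*-comm ℤ.∣ a ℤ.- b ∣ ℤ.∣ d ∣)))
                   (ℤ.∣⇒∣ᵤ m∣ad-bd)

triple≡0⇒affine-AP : ∀ {a b c} l s → triple a b c ≡ + 0 →
  (l ℤ.* a ℤ.+ s) ℤ.+ (l ℤ.* c ℤ.+ s) ≡ (l ℤ.* b ℤ.+ s) ℤ.+ (l ℤ.* b ℤ.+ s)
triple≡0⇒affine-AP {a} {b} {c} l s t≡0 = begin
  (l ℤ.* a ℤ.+ s) ℤ.+ (l ℤ.* c ℤ.+ s)                          ≡⟨ expand l a b c s ⟩
  l ℤ.* triple a b c ℤ.+ ((l ℤ.* b ℤ.+ s) ℤ.+ (l ℤ.* b ℤ.+ s))  ≡⟨ cong (λ t → l ℤ.* t ℤ.+ _) t≡0 ⟩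
  l ℤ.* + 0 ℤ.+ ((l ℤ.* b ℤ.+ s) ℤ.+ (l ℤ.* b ℤ.+ s))           ≡⟨ drop-zero l _ ⟩
  (l ℤ.* b ℤ.+ s) ℤ.+ (l ℤ.* b ℤ.+ s)                          ∎
  where
  open ≡-Reasoning
  expand : ∀ l a b c s → (l ℤ.* a ℤ.+ s) ℤ.+ (l ℤ.* c ℤ.+ s) ≡
           l ℤ.* (a ℤ.- + 2 ℤ.* b ℤ.+ c) ℤ.+ ((l ℤ.* b ℤ.+ s) ℤ.+ (l ℤ.* b ℤ.+ s))
  expand = solve-∀
  drop-zero : ∀ l u → l ℤ.* + 0 ℤ.+ u ≡ u
  drop-zero = solve-∀

triple-suc≡0 : ∀ {a b c} → a + c ≡ b + b → triple (+ suc a) (+ suc b) (+ suc c) ≡ + 0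
triple-suc≡0 {a} {b} {c} a+c≡b+b = begin
  triple (+ suc a) (+ suc b) (+ suc c)   ≡⟨ shift-out (+ a) (+ b) (+ c) ⟩
  (+ a ℤ.+ + c) ℤ.- (+ b ℤ.+ + b)       ≡⟨ cong₂ ℤ._-_ (ℤ.pos-+ a c) (ℤ.pos-+ b b) ⟨
  + (a + c) ℤ.- + (b + b)               ≡⟨ cong (λ m → + m ℤ.- + (b + b)) a+c≡b+b ⟩
  + (b + b) ℤ.- + (b + b)               ≡⟨ ℤ.+-inverseʳ (+ (b + b)) ⟩
  + 0                                   ∎
  where
  open ≡-Reasoning
  shift-out : ∀ a b c → (+ 1 ℤ.+ a) ℤ.- + 2 ℤ.* (+ 1 ℤ.+ b) ℤ.+ (+ 1 ℤ.+ c) ≡ (a ℤ.+ c) ℤ.- (b ℤ.+ b)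
  shift-out = solve-∀

+[m+o]-+[n+o]≡+m-+n : ∀ m n o → + (m + o) ℤ.- + (n + o) ≡ + m ℤ.- + n
+[m+o]-+[n+o]≡+m-+n m n o = trans (cong₂ ℤ._-_ (ℤ.pos-+ m o) (ℤ.pos-+ n o)) (cancel (+ m) (+ n) (+ o))
  where
  cancel : ∀ m n o → (m ℤ.+ o) ℤ.- (n ℤ.+ o) ≡ m ℤ.- n
  cancel = solve-∀

module _ {B : ℕ} .{{_ : NonZero B}} where

  %-digit : ∀ {e} t → e < B → (e + t * B) % B ≡ e
  %-digit {e} t e<B = trans ([m+kn]%n≡m%n e t B) (m<n⇒m%n≡m e<B)

  /-digit : ∀ {e} t → e < B → (e + t * B) / B ≡ t
  /-digit {e} t e<B = begin
    (e + t * B) / B    ≡⟨ +-distrib-/-∣ʳ e (n∣m*n t) ⟩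
    e / B + t * B / B  ≡⟨ cong₂ _+_ (m<n⇒m/n≡0 e<B) (m*n/n≡m t B) ⟩
    t                  ∎
    where open ≡-Reasoning

removal-bound : ∀ p q {n r k landed coll} → r + k ≡ n → landed ≤ k + coll →
                q * coll + q * n ≤ q * landed + p * n → r * q ≤ p * n
removal-bound p q {n} {r} {k} {landed} {coll} r+k≡n landed≤k+coll good =
  +-cancelʳ-≤ (q * k + q * coll) (r * q) (p * n) (begin
    r * q + (q * k + q * coll)  ≡⟨ regroup r q k coll ⟩
    q * coll + q * (r + k)      ≡⟨ cong (λ m → q * coll + q * m) r+k≡n ⟩
    q * coll + q * n            ≤⟨ good ⟩
    q * landed + p * n          ≤⟨ +-monoˡ-≤ (p * n) (*-monoʳ-≤ q landed≤k+coll) ⟩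
    q * (k + coll) + p * n      ≡⟨ distribute q k coll (p * n) ⟩
    p * n + (q * k + q * coll)  ∎)
  where
  open ≤-Reasoning
  regroup : ∀ r q k c → r * q + (q * k + q * c) ≡ q * c + q * (r + k)
  regroup = ℕ-solve-∀
  distribute : ∀ q k c m → q * (k + c) + m ≡ m + (q * k + q * c)
  distribute = ℕ-solve-∀

-- Bucketing an affine image of X

module Bucketing {n : ℕ} (x : Fin n → ℤ) (Q B b T : ℕ) .{{_ : NonZero Q}} .{{_ : NonZero B}}
  (2TB≤Q : T * B + T * B ≤ Q) (2b≤B : b + b ≤ B)
  (coprime : ∀ {i j} → i ≢ j → Coprime Q ℤ.∣ x i ℤ.- x j ∣) where

  InWindow : ℕ → Set
  InWindow w = w / B < T × w % B < b

  inWindow? : ∀ w → Dec (InWindow w)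
  inWindow? w = (w / B <? T) ×-dec (w % B <? b)

  inWindow⇒<TB : ∀ {w} → InWindow w → w < T * B
  inWindow⇒<TB {w} (w/B<T , _) = begin-strict
    w                  ≡⟨ m≡m%n+[m/n]*n w B ⟩
    w % B + w / B * B  <⟨ +-monoˡ-< _ (m%n<n w B) ⟩
    suc (w / B) * B    ≤⟨ *-monoˡ-≤ B w/B<T ⟩
    T * B              ∎
    where open ≤-Reasoning

  inWindow-+< : ∀ {w w'} → InWindow w → InWindow w' → w + w' < Q
  inWindow-+< w∈ w'∈ = <-≤-trans (+-mono-< (inWindow⇒<TB w∈) (inWindow⇒<TB w'∈)) 2TB≤Q

  inWindow-/-+ : ∀ {w w'} → InWindow w → InWindow w' → (w + w') / B ≡ w / B + w' / B
  inWindow-/-+ {w} {w'} (_ , w%B<b) (_ , w'%B<b) =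
    +-distrib-/ w w' (<-≤-trans (+-mono-< w%B<b w'%B<b) 2b≤B)

  windowPoint : Fin T → Fin b → ℕ
  windowPoint t e = toℕ e + toℕ t * B

  offset<B : (e : Fin b) → toℕ e < B
  offset<B e = <-≤-trans (Fin.toℕ<n e) (≤-trans (m≤m+n b b) 2b≤B)

  windowPoint-inWindow : ∀ t e → InWindow (windowPoint t e)
  windowPoint-inWindow t e = subst (_< T) (sym (/-digit (toℕ t) (offset<B e))) (Fin.toℕ<n t)
                           , subst (_< b) (sym (%-digit (toℕ t) (offset<B e))) (Fin.toℕ<n e)

  windowPoint<Q : ∀ t e → windowPoint t e < Q
  windowPoint<Q t e = <-≤-trans (inWindow⇒<TB (windowPoint-inWindow t e)) (≤-trans (m≤m+n _ _) 2TB≤Q)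

  windowPoint-injective : ∀ {t e t' e'} → windowPoint t e ≡ windowPoint t' e' → (t , e) ≡ (t' , e')
  windowPoint-injective {t} {e} {t'} {e'} eq = cong₂ _,_
    (Fin.toℕ-injective (begin
      toℕ t                  ≡⟨ /-digit (toℕ t) (offset<B e) ⟨
      windowPoint t e / B    ≡⟨ cong (_/ B) eq ⟩
      windowPoint t' e' / B  ≡⟨ /-digit (toℕ t') (offset<B e') ⟩
      toℕ t'                 ∎))
    (Fin.toℕ-injective (begin
      toℕ e                  ≡⟨ %-digit (toℕ t) (offset<B e) ⟨
      windowPoint t e % B    ≡⟨ cong (_% B) eq ⟩
      windowPoint t' e' % B  ≡⟨ %-digit (toℕ t') (offset<B e') ⟩
      toℕ e'                 ∎))
    where open ≡-Reasoning

  shift : Fin (b + b) → ℤ.ℤ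
  shift u = + toℕ u ℤ.- + b

  ∃shift≡difference : ∀ {e e'} → e < b → e' < b → ∃ λ u → shift u ≡ + e ℤ.- + e'
  ∃shift≡difference {e} {e'} e<b e'<b = fromℕ< u<b+b , (begin
    + toℕ (fromℕ< u<b+b) ℤ.- + b            ≡⟨ cong (λ m → + m ℤ.- + b) (Fin.toℕ-fromℕ< u<b+b) ⟩
    + (e + (b ∸ e')) ℤ.- + b                ≡⟨ cong (λ m → + (e + (b ∸ e')) ℤ.- + m) (m+[n∸m]≡n (<⇒≤ e'<b)) ⟨
    + (e + (b ∸ e')) ℤ.- + (e' + (b ∸ e'))  ≡⟨ +[m+o]-+[n+o]≡+m-+n e e' (b ∸ e') ⟩
    + e ℤ.- + e'                            ∎)
    where
    open ≡-Reasoning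
    u<b+b : e + (b ∸ e') < b + b
    u<b+b = +-mono-<-≤ e<b (m∸n≤m b e')

  module Cell (l s : ℕ) where

    residue : Fin n → ℕ
    residue i = (+ l ℤ.* x i ℤ.+ + s) %ℕ Q

    bucket : Fin n → ℕ
    bucket i = residue i / B

    Lands : Fin n → Set
    Lands i = InWindow (residue i)

    lands? : ∀ i → Dec (Lands i)
    lands? i = inWindow? (residue i)

    Collides : Fin n → Fin n → Set
    Collides i j = j Fin.< i × Lands i × Lands j × bucket j ≡ bucket i

    collides? : ∀ i j → Dec (Collides i j)
    collides? i j = (j Fin.<? i) ×-dec lands? i ×-dec lands? j ×-dec (bucket j ≟ bucket i)

    Survives : Fin n → Set
    Survives i = Lands i × ¬ ∃ (Collides i)

    survives? : ∀ i → Dec (Survives i)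
    survives? i = lands? i ×-dec ¬? (Fin.any? (collides? i))

    residue-mod : ∀ i → + residue i ≡ + l ℤ.* x i ℤ.+ + s mod Q
    residue-mod i = mod-sym (%ℕ-mod (+ l ℤ.* x i ℤ.+ + s))

    residue-AP : ∀ {i j k} → Lands i → Lands j → Lands k → triple (x i) (x j) (x k) ≡ + 0 →
                 residue i + residue k ≡ residue j + residue j
    residue-AP {i} {j} {k} Lᵢ Lⱼ Lₖ t≡0 = <-mod⇒≡ (inWindow-+< Lᵢ Lₖ) (inWindow-+< Lⱼ Lⱼ)
      (subst₂ (_≡_mod Q) (sym (ℤ.pos-+ (residue i) (residue k))) (sym (ℤ.pos-+ (residue j) (residue j)))
        (mod-trans (+-cong-mod (residue-mod i) (residue-mod k))
          (mod-trans (mod-reflexive (triple≡0⇒affine-AP (+ l) (+ s) t≡0))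
            (mod-sym (+-cong-mod (residue-mod j) (residue-mod j))))))

    bucket-AP : ∀ {i j k} → Lands i → Lands j → Lands k → triple (x i) (x j) (x k) ≡ + 0 →
                bucket i + bucket k ≡ bucket j + bucket j
    bucket-AP {i} {j} {k} Lᵢ Lⱼ Lₖ t≡0 = begin
      bucket i + bucket k          ≡⟨ inWindow-/-+ Lᵢ Lₖ ⟨
      (residue i + residue k) / B  ≡⟨ cong (_/ B) (residue-AP Lᵢ Lⱼ Lₖ t≡0) ⟩
      (residue j + residue j) / B  ≡⟨ inWindow-/-+ Lⱼ Lⱼ ⟩
      bucket j + bucket j          ∎
      where open ≡-Reasoning

    collision-mod : ∀ {i j} → Collides i j →
                    + l ℤ.* (x i ℤ.- x j) ≡ + (residue i % B) ℤ.- + (residue j % B) mod Q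
    collision-mod {i} {j} (_ , _ , _ , same-bucket) =
      mod-trans (mod-reflexive (distribute (+ l) (x i) (x j) (+ s)))
        (mod-trans (difference-cong-mod (mod-sym (residue-mod i)) (mod-sym (residue-mod j)))
          (mod-reflexive (begin
            + residue i ℤ.- + residue j
              ≡⟨ cong₂ (λ a a' → + a ℤ.- + a') (m≡m%n+[m/n]*n (residue i) B) (m≡m%n+[m/n]*n (residue j) B) ⟩
            + (residue i % B + bucket i * B) ℤ.- + (residue j % B + bucket j * B)
              ≡⟨ cong (λ c → + (residue i % B + bucket i * B) ℤ.- + (residue j % B + c * B)) same-bucket ⟩
            + (residue i % B + bucket i * B) ℤ.- + (residue j % B + bucket i * B)
              ≡⟨ +[m+o]-+[n+o]≡+m-+n (residue i % B) (residue j % B) (bucket i * B) ⟩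
            + (residue i % B) ℤ.- + (residue j % B) ∎)))
      where
      open ≡-Reasoning
      distribute : ∀ l a a' s → l ℤ.* (a ℤ.- a') ≡ (l ℤ.* a ℤ.+ s) ℤ.- (l ℤ.* a' ℤ.+ s)
      distribute = solve-∀

    lands≤survives+collisions : ∀ i → 𝟙 (lands? i) ≤ 𝟙 (survives? i) + count (collides? i)
    lands≤survives+collisions i = 𝟙-≤ (lands? i) λ Lᵢ → by-cases Lᵢ (Fin.any? (collides? i))
      where
      by-cases : Lands i → Dec (∃ (Collides i)) → 1 ≤ 𝟙 (survives? i) + count (collides? i)
      by-cases Lᵢ (no none)      = ≤-trans (≤-reflexive (sym (𝟙-yes (survives? i) (Lᵢ , none)))) (m≤m+n _ _)
      by-cases Lᵢ (yes (j , c)) = ≤-trans (≤-reflexive (sym (𝟙-yes (collides? i j) c)))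
                                    (≤-trans (term≤sum _ j) (m≤n+m _ _))

    survivor-buckets-injective : ∀ {i j} → Survives i → Survives j → bucket i ≡ bucket j → i ≡ j
    survivor-buckets-injective {i} {j} (Lᵢ , ¬Cᵢ) (Lⱼ , ¬Cⱼ) same with Fin.<-cmp i j
    ... | tri< i<j _ _ = contradiction (i , i<j , Lⱼ , Lᵢ , same) ¬Cⱼ
    ... | tri≈ _ i≡j _ = i≡j
    ... | tri> _ _ j<i = contradiction (j , j<i , Lᵢ , Lⱼ , sym same) ¬Cᵢ

    removed : Subset n
    removed = tabulate (isNo ∘ survives?)

    ∣removed∣+count-survives≡n : ∣ removed ∣ + count survives? ≡ n
    ∣removed∣+count-survives≡n = ∣tabulate-isNo∣+count≡n survives?

    compression : CompressibleInto x removed T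
    compression = y , y-injective , y-AP , y-range
      where
      survivor : ∀ {i} → i ∉ removed → Survives i
      survivor {i} = ∉tabulate-isNo survives? i
      y : Fin n → ℤ.ℤ
      y i = + suc (bucket i)
      y-injective : ∀ i j → i ∉ removed → j ∉ removed → y i ≡ y j → i ≡ j
      y-injective i j i∉ j∉ yᵢ≡yⱼ =
        survivor-buckets-injective (survivor i∉) (survivor j∉) (suc-injective (ℤ.+-injective yᵢ≡yⱼ))
      y-AP : ∀ i j k → i ∉ removed → j ∉ removed → k ∉ removed →
             triple (x i) (x j) (x k) ≡ + 0 → triple (y i) (y j) (y k) ≡ + 0
      y-AP i j k i∉ j∉ k∉ t≡0 = triple-suc≡0 {bucket i} {bucket j} {bucket k}
        (bucket-AP (proj₁ (survivor i∉)) (proj₁ (survivor j∉)) (proj₁ (survivor k∉)) t≡0)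
      y-range : ∀ i → i ∉ removed → (+ 1 ℤ.≤ y i) × (y i ℤ.≤ + T)
      y-range i i∉ = ℤ.+≤+ (s≤s z≤n) , ℤ.+≤+ (proj₁ (proj₁ (survivor i∉)))

  -- For fixed l, each of the T b window points is the residue of exactly one shift s.
  module LandingCount (l : ℕ) (i : Fin n) where

    shiftTo : ℕ → Fin Q
    shiftTo w = fromℕ< (n%ℕd<d (+ w ℤ.- + l ℤ.* x i) Q)

    residue-shiftTo : ∀ {w} → w < Q → Cell.residue l (toℕ (shiftTo w)) i ≡ w
    residue-shiftTo {w} w<Q = <-mod⇒≡ (n%ℕd<d (+ l ℤ.* x i ℤ.+ + toℕ (shiftTo w)) Q) w<Q
      (mod-trans (Cell.residue-mod l (toℕ (shiftTo w)) i)
        (mod-trans (+-cong-mod (mod-reflexive {a = + l ℤ.* x i} refl) shift-mod)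
          (mod-reflexive (cancel (+ l ℤ.* x i) (+ w)))))
      where
      shift-mod : + toℕ (shiftTo w) ≡ + w ℤ.- + l ℤ.* x i mod Q
      shift-mod = subst (λ r → + r ≡ _ mod Q) (sym (Fin.toℕ-fromℕ< _))
                    (mod-sym (%ℕ-mod (+ w ℤ.- + l ℤ.* x i)))
      cancel : ∀ a w → a ℤ.+ (w ℤ.- a) ≡ w
      cancel = solve-∀

    toWindow : Fin (T * b) → Fin Q
    toWindow a = shiftTo (uncurry windowPoint (remQuot {T} b a))

    residue-toWindow : ∀ a → Cell.residue l (toℕ (toWindow a)) i ≡ uncurry windowPoint (remQuot {T} b a)
    residue-toWindow a = residue-shiftTo (uncurry windowPoint<Q (remQuot {T} b a))

    toWindow-injective : Injective _≡_ _≡_ toWindow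
    toWindow-injective {a} {a'} eq = begin
      a                                    ≡⟨ Fin.combine-remQuot {T} b a ⟨
      uncurry combine (remQuot {T} b a)    ≡⟨ cong (uncurry combine) (windowPoint-injective (begin
        uncurry windowPoint (remQuot {T} b a)   ≡⟨ residue-toWindow a ⟨
        Cell.residue l (toℕ (toWindow a)) i     ≡⟨ cong (λ s → Cell.residue l (toℕ s) i) eq ⟩
        Cell.residue l (toℕ (toWindow a')) i    ≡⟨ residue-toWindow a' ⟩
        uncurry windowPoint (remQuot {T} b a')  ∎)) ⟩
      uncurry combine (remQuot {T} b a')   ≡⟨ Fin.combine-remQuot {T} b a' ⟩
      a'                                   ∎
      where open ≡-Reasoning

    landing-count : T * b ≤ count (λ (s : Fin Q) → Cell.lands? l (toℕ s) i)
    landing-count = injection⇒≤count (λ s → Cell.lands? l (toℕ s) i) toWindow toWindow-injective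
      λ a → subst InWindow (sym (residue-toWindow a)) (uncurry windowPoint-inWindow (remQuot {T} b a))

  -- A collision of i and j pins l (x i - x j) modulo Q to one of 2b shifts, and by
  -- coprimality each shift is attained by at most one dilation l.
  module CollisionCount (s : ℕ) (i j : Fin n) where

    Window : Fin Q → Fin (b + b) → Set
    Window l u = j Fin.< i × + toℕ l ℤ.* (x i ℤ.- x j) ≡ shift u mod Q

    window? : ∀ l u → Dec (Window l u)
    window? l u = (j Fin.<? i) ×-dec (+ toℕ l ℤ.* (x i ℤ.- x j) ≡? shift u mod Q)

    window-unique : ∀ u l l' → Window l u → Window l' u → l ≡ l'
    window-unique u l l' (j<i , ld≡shift) (_ , l'd≡shift) =
      Fin.toℕ-injective (<-mod⇒≡ (Fin.toℕ<n l) (Fin.toℕ<n l')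
        (*-cancelʳ-mod (coprime (≢-sym (Fin.<⇒≢ j<i))) (mod-trans ld≡shift (mod-sym l'd≡shift))))

    collision⇒window : ∀ l → Cell.Collides (toℕ l) s i j → ∃ (Window l)
    collision⇒window l c@(j<i , (_ , eᵢ<b) , (_ , eⱼ<b) , _) =
      let u , shift≡ = ∃shift≡difference eᵢ<b eⱼ<b
      in u , j<i , mod-trans (Cell.collision-mod (toℕ l) s c) (mod-reflexive (sym shift≡))

    collision-count : count (λ (l : Fin Q) → Cell.collides? (toℕ l) s i j) ≤ b + b
    collision-count = begin
      count (λ (l : Fin Q) → Cell.collides? (toℕ l) s i j)
        ≤⟨ count≤∑count (λ l → Cell.collides? (toℕ l) s i j) window? collision⇒window ⟩
      sum (λ u → count (λ l → window? l u))
        ≤⟨ sum-mono-≤ (λ u → unique⇒count≤1 (λ l → window? l u) (window-unique u)) ⟩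
      sum {b + b} (λ _ → 1)
        ≡⟨ trans (sum-const (b + b) 1) (*-identityʳ (b + b)) ⟩
      b + b ∎
      where open ≤-Reasoning

  cellSum : (ℕ → ℕ → ℕ) → ℕ
  cellSum f = sum (λ (l : Fin Q) → sum (λ (s : Fin Q) → f (toℕ l) (toℕ s)))

  landedTotal collisionTotal : ℕ → ℕ → ℕ
  landedTotal l s = count (Cell.lands? l s)
  collisionTotal l s = sum (λ (i : Fin n) → count (Cell.collides? l s i))

  cellSum-affine : ∀ q c f → cellSum (λ l s → q * f l s + c) ≡ q * cellSum f + Q * (Q * c)
  cellSum-affine q c f = begin
    cellSum (λ l s → q * f l s + c)
      ≡⟨ sum-cong {Q} (λ l → sum-affine q c (λ (s : Fin Q) → f (toℕ l) (toℕ s))) ⟩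
    sum (λ (l : Fin Q) → q * sum (λ (s : Fin Q) → f (toℕ l) (toℕ s)) + Q * c)
      ≡⟨ sum-affine q (Q * c) (λ (l : Fin Q) → sum (λ (s : Fin Q) → f (toℕ l) (toℕ s))) ⟩
    q * cellSum f + Q * (Q * c) ∎
    where open ≡-Reasoning

  cellSum≤⇒∃cell : ∀ {f g} → cellSum f ≤ cellSum g →
                   ∃ λ (l : Fin Q) → ∃ λ (s : Fin Q) → f (toℕ l) (toℕ s) ≤ g (toℕ l) (toℕ s)
  cellSum≤⇒∃cell Σf≤Σg =
    let l , Σₛf≤Σₛg = sum≤sum⇒∃≤ _ _ Σf≤Σg
        s , f≤g     = sum≤sum⇒∃≤ _ _ Σₛf≤Σₛg
    in l , s , f≤g

  landedTotal-bound : Q * (n * (T * b)) ≤ cellSum landedTotal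
  landedTotal-bound = begin
    Q * (n * (T * b))
      ≡⟨ trans (sum-const Q _) (cong (Q *_) (sum-const n _)) ⟨
    sum {Q} (λ _ → sum {n} (λ _ → T * b))
      ≤⟨ sum-mono-≤ {Q} (λ l → sum-mono-≤ (λ (i : Fin n) → LandingCount.landing-count (toℕ l) i)) ⟩
    sum (λ (l : Fin Q) → sum (λ (i : Fin n) → count (λ (s : Fin Q) → Cell.lands? (toℕ l) (toℕ s) i)))
      ≡⟨ sum-cong {Q} (λ l → ∑-comm (λ (i : Fin n) (s : Fin Q) → 𝟙 (Cell.lands? (toℕ l) (toℕ s) i))) ⟩
    cellSum landedTotal ∎
    where open ≤-Reasoning

  collisionTotal-bound : cellSum collisionTotal ≤ Q * (n * (n * (b + b)))
  collisionTotal-bound = begin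
    cellSum collisionTotal
      ≡⟨ ∑-comm {Q} {Q} (λ (l s : Fin Q) → collisionTotal (toℕ l) (toℕ s)) ⟩
    sum (λ (s : Fin Q) → sum (λ (l : Fin Q) → sum (λ (i : Fin n) → count (Cell.collides? (toℕ l) (toℕ s) i))))
      ≡⟨ sum-cong {Q} (λ s → ∑-comm (λ (l : Fin Q) (i : Fin n) → count (Cell.collides? (toℕ l) (toℕ s) i))) ⟩
    sum (λ (s : Fin Q) → sum (λ (i : Fin n) → sum (λ (l : Fin Q) → count (Cell.collides? (toℕ l) (toℕ s) i))))
      ≡⟨ sum-cong {Q} (λ s → sum-cong (λ (i : Fin n) →
           ∑-comm (λ (l : Fin Q) (j : Fin n) → 𝟙 (Cell.collides? (toℕ l) (toℕ s) i j)))) ⟩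
    sum (λ (s : Fin Q) → sum (λ (i : Fin n) → sum (λ (j : Fin n) → count (λ (l : Fin Q) → Cell.collides? (toℕ l) (toℕ s) i j))))
      ≤⟨ sum-mono-≤ {Q} (λ s → sum-mono-≤ (λ (i : Fin n) → sum-mono-≤ (λ (j : Fin n) →
           CollisionCount.collision-count (toℕ s) i j))) ⟩
    sum {Q} (λ _ → sum {n} (λ _ → sum {n} (λ _ → b + b)))
      ≡⟨ trans (sum-const Q _) (cong (Q *_) (trans (sum-const n _) (cong (n *_) (sum-const n _)))) ⟩
    Q * (n * (n * (b + b))) ∎
    where open ≤-Reasoning

  cell-compression : ∀ p q l s → q * collisionTotal l s + q * n ≤ q * landedTotal l s + p * n →
                     ∃ λ (R : Subset n) → (∣ R ∣ * q ≤ p * n) × CompressibleInto x R T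
  cell-compression p q l s good = Cell.removed l s
    , removal-bound p q (Cell.∣removed∣+count-survives≡n l s) landed≤survivors+collisions good
    , Cell.compression l s
    where
    landed≤survivors+collisions : landedTotal l s ≤ count (Cell.survives? l s) + collisionTotal l s
    landed≤survivors+collisions = ≤-trans (sum-mono-≤ (Cell.lands≤survives+collisions l s))
      (≤-reflexive (∑-distrib-+ (λ i → 𝟙 (Cell.survives? l s i)) (λ i → count (Cell.collides? l s i))))

  compressible : ∀ p q → q * (n * (b + b)) + Q * q ≤ q * (T * b) + Q * p →
                 ∃ λ (R : Subset n) → (∣ R ∣ * q ≤ p * n) × CompressibleInto x R T
  compressible p q fits =
    let l , s , good = cellSum≤⇒∃cell {λ l s → q * collisionTotal l s + q * n}
                                      {λ l s → q * landedTotal l s + p * n} on-average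
    in cell-compression p q (toℕ l) (toℕ s) good
    where
    on-average : cellSum (λ l s → q * collisionTotal l s + q * n) ≤ cellSum (λ l s → q * landedTotal l s + p * n)
    on-average = begin
      cellSum (λ l s → q * collisionTotal l s + q * n)
        ≡⟨ cellSum-affine q (q * n) collisionTotal ⟩
      q * cellSum collisionTotal + Q * (Q * (q * n))
        ≤⟨ +-monoˡ-≤ (Q * (Q * (q * n))) (*-monoʳ-≤ q collisionTotal-bound) ⟩
      q * (Q * (n * (n * (b + b)))) + Q * (Q * (q * n))
        ≡⟨ factor-left q Q n b ⟩
      (Q * n) * (q * (n * (b + b)) + Q * q)
        ≤⟨ *-monoʳ-≤ (Q * n) fits ⟩
      (Q * n) * (q * (T * b) + Q * p)
        ≡⟨ factor-right q Q n T b p ⟩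
      q * (Q * (n * (T * b))) + Q * (Q * (p * n))
        ≤⟨ +-monoˡ-≤ (Q * (Q * (p * n))) (*-monoʳ-≤ q landedTotal-bound) ⟩
      q * cellSum landedTotal + Q * (Q * (p * n))
        ≡⟨ cellSum-affine q (p * n) landedTotal ⟨
      cellSum (λ l s → q * landedTotal l s + p * n) ∎
      where
      open ≤-Reasoning
      factor-left : ∀ q Q n b → q * (Q * (n * (n * (b + b)))) + Q * (Q * (q * n)) ≡ (Q * n) * (q * (n * (b + b)) + Q * q)
      factor-left = ℕ-solve-∀
      factor-right : ∀ q Q n T b p → (Q * n) * (q * (T * b) + Q * p) ≡ q * (Q * (n * (T * b))) + Q * (Q * (p * n))
      factor-right = ℕ-solve-∀

-- Choice of parameters

const-subpolynomial : ∀ c → Subpolynomial (λ _ → c)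
const-subpolynomial c k = c ^ suc k , λ _ c^k≤n → c^k≤n

n∣n! : ∀ {n} → 0 < n → n ∣ n !
n∣n! {suc n} _ = m∣m*n (n !)

coprime-suc : ∀ {N m d} → m ! ∣ N → 0 < d → d ≤ m → Coprime (suc N) d
coprime-suc {N} {m} {d} m!∣N 0<d d≤m {c} (c∣1+N , c∣d) =
  ∣1⇒≡1 (∣m+n∣m⇒∣n (subst (c ∣_) (+-comm 1 N) c∣1+N) c∣N)
  where
  0<c : 0 < c
  0<c = n≢0⇒n>0 λ c≡0 → >⇒≢ 0<d (0∣⇒≡0 (subst (_∣ d) c≡0 c∣d))
  c∣N : c ∣ N
  c∣N = ∣-trans (n∣n! 0<c) (∣-trans (m≤n⇒m!∣n! (≤-trans (∣⇒≤ {{>-nonZero 0<d}} c∣d) d≤m)) m!∣N)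

parameters-fit : ∀ {p q} n b .{{_ : NonZero n}} .{{_ : NonZero b}} → 3 * q < 4 * p →
  let T = n * (4 * q) ; Q = suc (T * (b + b) + T * (b + b)) in
  q * (n * (b + b)) + Q * q ≤ q * (T * b) + Q * p
parameters-fit {p} {q} n b 3q<4p = *-cancelˡ-≤ 4 (begin
  4 * (q * (n * (b + b)) + Q * q)          ≡⟨ split-lhs q n b Q ⟩
  (8 * (q * m) + Q * q) + 3 * (Q * q)      ≤⟨ +-monoˡ-≤ (3 * (Q * q)) 8qm+Qq≤16q²m+Q ⟩
  (16 * (q * (q * m)) + Q) + 3 * (Q * q)   ≡⟨ collect q m Q ⟩
  16 * (q * (q * m)) + Q * (3 * q + 1)     ≤⟨ +-monoʳ-≤ (16 * (q * (q * m))) (*-monoʳ-≤ Q 3q+1≤4p) ⟩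
  16 * (q * (q * m)) + Q * (4 * p)         ≡⟨ split-rhs q n b Q p ⟩
  4 * (q * (T * b) + Q * p)                ∎)
  where
  open ≤-Reasoning
  T Q m : ℕ
  T = n * (4 * q)
  Q = suc (T * (b + b) + T * (b + b))
  m = n * b
  instance
    m≢0 : NonZero m
    m≢0 = m*n≢0 n b
  3q+1≤4p : 3 * q + 1 ≤ 4 * p
  3q+1≤4p = subst (_≤ 4 * p) (+-comm 1 (3 * q)) 3q<4p
  q+8qm≤1+16qm : q + 8 * (q * m) ≤ 1 + 16 * (q * m)
  q+8qm≤1+16qm = begin
    q + 8 * (q * m)            ≤⟨ +-monoˡ-≤ (8 * (q * m)) (≤-trans (m≤m*n q m) (m≤n*m (q * m) 8)) ⟩
    8 * (q * m) + 8 * (q * m)  ≡⟨ *-distribʳ-+ (q * m) 8 8 ⟨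
    16 * (q * m)               ≤⟨ m≤n+m _ 1 ⟩
    1 + 16 * (q * m)           ∎
  expand-Q : ∀ q n b → suc (n * (4 * q) * (b + b) + n * (4 * q) * (b + b)) ≡ 1 + 16 * (q * (n * b))
  expand-Q = ℕ-solve-∀
  spread : ∀ q m → 8 * (q * m) + (1 + 16 * (q * m)) * q ≡ (q + 8 * (q * m)) + 16 * (q * (q * m))
  spread = ℕ-solve-∀
  8qm+Qq≤16q²m+Q : 8 * (q * m) + Q * q ≤ 16 * (q * (q * m)) + Q
  8qm+Qq≤16q²m+Q = subst (λ Q → 8 * (q * m) + Q * q ≤ 16 * (q * (q * m)) + Q) (sym (expand-Q q n b))
    (begin
    8 * (q * m) + (1 + 16 * (q * m)) * q     ≡⟨ spread q m ⟩
    (q + 8 * (q * m)) + 16 * (q * (q * m))   ≤⟨ +-monoˡ-≤ (16 * (q * (q * m))) q+8qm≤1+16qm ⟩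
    (1 + 16 * (q * m)) + 16 * (q * (q * m))  ≡⟨ +-comm (1 + 16 * (q * m)) _ ⟩
    16 * (q * (q * m)) + (1 + 16 * (q * m))  ∎)
  split-lhs : ∀ q n b Q → 4 * (q * (n * (b + b)) + Q * q) ≡ (8 * (q * (n * b)) + Q * q) + 3 * (Q * q)
  split-lhs = ℕ-solve-∀
  collect : ∀ q m Q → (16 * (q * (q * m)) + Q) + 3 * (Q * q) ≡ 16 * (q * (q * m)) + Q * (3 * q + 1)
  collect = ℕ-solve-∀
  split-rhs : ∀ q n b Q p → 16 * (q * (q * (n * b))) + Q * (4 * p) ≡ 4 * (q * (n * (4 * q) * b) + Q * p)
  split-rhs = ℕ-solve-∀

∣x-x∣≤∑∑ : ∀ {n} (x : Fin n → ℤ) i j → ℤ.∣ x i ℤ.- x j ∣ ≤ sum (λ i → sum (λ j → ℤ.∣ x i ℤ.- x j ∣))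
∣x-x∣≤∑∑ x i j =
  ≤-trans (term≤sum (λ j → ℤ.∣ x i ℤ.- x j ∣) j) (term≤sum (λ i → sum (λ j → ℤ.∣ x i ℤ.- x j ∣)) i)

mainTheorem2 : ∀ (p q : ℕ) → 3 * q < 4 * p → p < q →
    Σ (ℕ → ℕ) λ h → Subpolynomial h ×
      (∀ (n : ℕ) (x : Fin n → ℤ) → Injective _≡_ _≡_ x →
        ∃ λ (R : Subset n) → (∣ R ∣ * q ≤ p * n) × CompressibleInto x R (n * h n))
mainTheorem2 p zero      _     ()
mainTheorem2 p q@(suc _) 3q<4p _ = (λ _ → 4 * q) , const-subpolynomial (4 * q) , compress
  where
  compress : ∀ n (x : Fin n → ℤ) → Injective _≡_ _≡_ x →
             ∃ λ (R : Subset n) → (∣ R ∣ * q ≤ p * n) × CompressibleInto x R (n * (4 * q))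
  compress zero      x _     = [] , z≤n , (λ ()) , (λ ()) , (λ ()) , (λ ())
  compress n@(suc _) x x-inj = Bucketing.compressible x Q B b T {{_}} {{B≢0}} (n≤1+n _) ≤-refl coprime p q
                                 (parameters-fit {p} {q} n b {{_}} {{F !≢0}} 3q<4p)
    where
    F b B T Q : ℕ
    F = sum (λ i → sum (λ j → ℤ.∣ x i ℤ.- x j ∣))
    b = F !
    B = b + b
    T = n * (4 * q)
    Q = suc (T * B + T * B)
    B≢0 : NonZero B
    B≢0 = >-nonZero (+-mono-< (1≤n! F) (1≤n! F))
    F!∣TB+TB : F ! ∣ T * B + T * B
    F!∣TB+TB = ∣m∣n⇒∣m+n F!∣TB F!∣TB
      where
      F!∣TB : F ! ∣ T * B
      F!∣TB = ∣n⇒∣m*n T (∣m∣n⇒∣m+n ∣-refl ∣-refl)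
    coprime : ∀ {i j} → i ≢ j → Coprime Q ℤ.∣ x i ℤ.- x j ∣
    coprime {i} {j} i≢j = coprime-suc F!∣TB+TB
      (n≢0⇒n>0 λ d≡0 → i≢j (x-inj (ℤ.i-j≡0⇒i≡j (x i) (x j) (ℤ.∣i∣≡0⇒i≡0 d≡0))))
      (∣x-x∣≤∑∑ x i j)
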